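{- Let $m\ge0$ and $\lambda,\mu$ partitions of $m$. Then there exists $n\in N(m)$ with $V^{n}(\lambda)\cap V^{n}(\mu)\neq\emptyset$.
   Context: $N(m)=\{n\in\mathbb Z: n\ge m,\ n\equiv m\pmod 2\}$. A skew shape is a vertical strip if it has at most one box in each row. For a partition $\lambda$, $V^n(\lambda)$ is the set of partitions $\nu$ with $|\nu|=n$ for which there is a chain $\lambda=\nu^0\subseteq\nu^1\subseteq\dots\subseteq\nu^t=\nu$ of partitions with each $\nu^s/\nu^{s-1}$ a vertical strip of even size. -}

module Defs where

open import Data.Nat using (ℕ; zero; suc; _+_; _∸_; _≤_; _≥_; _>_; _%_)
open import Data.Nat.Divisibility using (_∣_)
open import Data.List using (List; []; _∷_)
open import Data.Nat.ListAction using (sum)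
open import Data.List.Relation.Unary.All using (All)
open import Data.List.Relation.Unary.Linked using (Linked)
open import Data.Product using (_×_)
open import Relation.Binary.PropositionalEquality using (_≡_)
open import Relation.Binary.Construct.Closure.ReflexiveTransitive using (Star)

IsPartition : List ℕ → Set
IsPartition l = All (λ x → x > 0) l × Linked _≥_ l

size : List ℕ → ℕ
size = sum

-- i-th part (0-indexed), padded with zeros
part : List ℕ → ℕ → ℕ
part []      _       = 0
part (x ∷ _) zero    = x
part (_ ∷ l) (suc i) = part l i

_⊆ₚ_ : List ℕ → List ℕ → Set
l ⊆ₚ n = ∀ i → part l i ≤ part n i

VerticalStrip : List ℕ → List ℕ → Set
VerticalStrip l n = (l ⊆ₚ n) × (∀ i → part n i ≤ suc (part l i))

EvenStripStep : List ℕ → List ℕ → Set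
EvenStripStep l n = IsPartition l × IsPartition n × VerticalStrip l n × (2 ∣ (size n ∸ size l))

V : ℕ → List ℕ → List ℕ → Set
V n l ν = IsPartition ν × size ν ≡ n × Star EvenStripStep l ν

-- n ∈ N(m)  (n ≥ m, n ≡ m mod 2); since m ≥ 0, such n are naturals
InN : ℕ → ℕ → Set
InN m n = m ≤ n × n % 2 ≡ m % 2

module Submission where

-- Both partitions can be grown, by even vertical strips, into shapes (C^L, 1^D) with C = m + 2
-- and L the sum of their lengths: each move adds one box at the end of a row that is not yet
-- full together with one box in a new row of length 1 at the bottom, and rows are filled to
-- length C from the top down. The two resulting D's have the parity of m - L C, so appending
-- pairs of ones to the first columns makes the two shapes equal.

open import Defs
open import Data.Nat using (ℕ; zero; suc; _+_; _*_; _≤_; _<_; _∸_; z≤n; s≤s)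
open import Data.Nat.Properties
open import Data.Nat.Divisibility using (_∣_; divides)
open import Data.Nat.DivMod using ([m+kn]%n≡m%n)
open import Data.Nat.ListAction.Properties using (sum-++)
open import Data.List using (List; []; _∷_; _++_; length; replicate)
open import Data.List.Properties using (++-assoc; ++-identityʳ)
open import Data.List.Relation.Unary.All using ([]; _∷_)
open import Data.List.Relation.Unary.Linked using ([]; [-]; _∷_)
open import Data.Product using (_×_; _,_; ∃-syntax)
open import Relation.Binary.PropositionalEquality
  using (_≡_; refl; sym; trans; cong; cong₂; subst; subst₂; module ≡-Reasoning)
open import Relation.Binary.Construct.Closure.ReflexiveTransitive using (Star; ε; _◅_; _◅◅_)

Chain : List ℕ → List ℕ → Set
Chain = Star EvenStripStep

ones : ℕ → List ℕ
ones k = replicate k 1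

replicate-++ : ∀ {A : Set} a b (x : A) → replicate a x ++ replicate b x ≡ replicate (a + b) x
replicate-++ zero    b x = refl
replicate-++ (suc a) b x = cong (x ∷_) (replicate-++ a b x)

replicate-++-∷ : ∀ {A : Set} i (x : A) ys → replicate i x ++ x ∷ ys ≡ x ∷ replicate i x ++ ys
replicate-++-∷ zero    x ys = refl
replicate-++-∷ (suc i) x ys = cong (x ∷_) (replicate-++-∷ i x ys)

++-ones-++ : ∀ τ a b → (τ ++ ones a) ++ ones b ≡ τ ++ ones (a + b)
++-ones-++ τ a b = trans (++-assoc τ (ones a) (ones b)) (cong (τ ++_) (replicate-++ a b 1))

size-++-ones : ∀ τ k → size (τ ++ ones k) ≡ size τ + k
size-++-ones τ k = trans (sum-++ τ (ones k)) (cong (size τ +_) (size-ones k))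
  where
  size-ones : ∀ k → size (ones k) ≡ k
  size-ones zero    = refl
  size-ones (suc k) = cong suc (size-ones k)

part0≤size : ∀ l → part l 0 ≤ size l
part0≤size []      = z≤n
part0≤size (x ∷ l) = m≤m+n x (size l)

part-ones≤1 : ∀ k i → part (ones k) i ≤ 1
part-ones≤1 zero    i       = z≤n
part-ones≤1 (suc k) zero    = ≤-refl
part-ones≤1 (suc k) (suc i) = part-ones≤1 k i

part-replicate-++-0 : ∀ i {x} l → part l 0 ≤ x → part (replicate i x ++ l) 0 ≤ x
part-replicate-++-0 zero    l h = h
part-replicate-++-0 (suc i) l h = ≤-refl

part-++-ones-0 : ∀ τ k {x} → 0 < x → part τ 0 ≤ x → part (τ ++ ones k) 0 ≤ x
part-++-ones-0 []      k x>0 _ = ≤-trans (part-ones≤1 k 0) x>0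
part-++-ones-0 (_ ∷ _) k _   h = h

IsPartition-∷ : ∀ {x l} → 0 < x → part l 0 ≤ x → IsPartition l → IsPartition (x ∷ l)
IsPartition-∷ {l = []}    x>0 _ _           = (x>0 ∷ []) , [-]
IsPartition-∷ {l = _ ∷ _} x>0 h (pos , dec) = (x>0 ∷ pos) , (h ∷ dec)

IsPartition-∷⁻ : ∀ {x l} → IsPartition (x ∷ l) → 0 < x × part l 0 ≤ x × IsPartition l
IsPartition-∷⁻ {l = []}    (x>0 ∷ [] , _)          = x>0 , z≤n , ([] , [])
IsPartition-∷⁻ {l = _ ∷ _} (x>0 ∷ pos , h ∷ dec) = x>0 , h , (pos , dec)

IsPartition-ones : ∀ k → IsPartition (ones k)
IsPartition-ones zero    = [] , []
IsPartition-ones (suc k) = IsPartition-∷ (s≤s z≤n) (part-ones≤1 k 0) (IsPartition-ones k)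

IsPartition-++-ones : ∀ τ k → IsPartition τ → IsPartition (τ ++ ones k)
IsPartition-++-ones []      k _ = IsPartition-ones k
IsPartition-++-ones (x ∷ τ) k p with IsPartition-∷⁻ p
... | x>0 , τ≤x , pτ = IsPartition-∷ x>0 (part-++-ones-0 τ k x>0 τ≤x) (IsPartition-++-ones τ k pτ)

VerticalStrip-∷ : ∀ {a b l n} → a ≤ b → b ≤ suc a → VerticalStrip l n →
                  VerticalStrip (a ∷ l) (b ∷ n)
VerticalStrip-∷ a≤b b≤1+a (sub , strip) =
  (λ { zero → a≤b ; (suc i) → sub i }) , (λ { zero → b≤1+a ; (suc i) → strip i })

VerticalStrip-++-ones : ∀ τ k → VerticalStrip τ (τ ++ ones k)
VerticalStrip-++-ones []      k = (λ _ → z≤n) , part-ones≤1 k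
VerticalStrip-++-ones (x ∷ τ) k = VerticalStrip-∷ ≤-refl (n≤1+n x) (VerticalStrip-++-ones τ k)

⊆ₚ⇒size≤ : ∀ l n → l ⊆ₚ n → size l ≤ size n
⊆ₚ⇒size≤ []      n        _   = z≤n
⊆ₚ⇒size≤ (x ∷ l) []       sub = +-mono-≤ (sub 0) (⊆ₚ⇒size≤ l [] (λ i → sub (suc i)))
⊆ₚ⇒size≤ (x ∷ l) (y ∷ n) sub = +-mono-≤ (sub 0) (⊆ₚ⇒size≤ l n (λ i → sub (suc i)))

target-IsPartition : ∀ {l n} → EvenStripStep l n → IsPartition n
target-IsPartition (_ , pn , _) = pn

Chain-IsPartition : ∀ {l n} → Chain l n → IsPartition l → IsPartition n
Chain-IsPartition ε          pl = pl
Chain-IsPartition (s ◅ rest) _  = Chain-IsPartition rest (target-IsPartition s)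

Chain-size : ∀ {l n} → Chain l n → ∃[ k ] size n ≡ size l + k * 2
Chain-size ε = 0 , sym (+-identityʳ _)
Chain-size {l} (_◅_ {j = n} (_ , _ , (sub , _) , divides q eq) rest) with Chain-size rest
... | k , e = q + k , (begin
    _                      ≡⟨ e ⟩
    size n + k * 2         ≡⟨ cong (_+ k * 2) (sym (m+[n∸m]≡n (⊆ₚ⇒size≤ l n sub))) ⟩
    size l + (size n ∸ size l) + k * 2 ≡⟨ cong (λ d → size l + d + k * 2) eq ⟩
    size l + q * 2 + k * 2 ≡⟨ +-assoc (size l) (q * 2) (k * 2) ⟩
    size l + (q * 2 + k * 2) ≡⟨ cong (size l +_) (sym (*-distribʳ-+ 2 q k)) ⟩
    size l + (q + k) * 2   ∎)
  where open ≡-Reasoning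

evenStripStep : ∀ {l n} → IsPartition l → IsPartition n → VerticalStrip l n →
                size n ≡ 2 + size l → EvenStripStep l n
evenStripStep {l} pl pn strip grow =
  pl , pn , strip , divides 1 (trans (cong (_∸ size l) grow) (m+n∸n≡m 2 (size l)))

appendOnes₂ : ∀ {l} → IsPartition l → EvenStripStep l (l ++ ones 2)
appendOnes₂ {l} pl =
  evenStripStep pl (IsPartition-++-ones l 2 pl) (VerticalStrip-++-ones l 2)
    (trans (size-++-ones l 2) (+-comm (size l) 2))

appendEvenOnes : ∀ {ν} → IsPartition ν → ∀ t → Chain ν (ν ++ ones (t * 2))
appendEvenOnes {ν} pν zero    = subst (Chain ν) (sym (++-identityʳ ν)) ε
appendEvenOnes {ν} pν (suc t) =
  appendOnes₂ pν ◅ subst (Chain _) (++-assoc ν (ones 2) (ones (t * 2)))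
                     (appendEvenOnes (IsPartition-++-ones ν 2 pν) t)

growHead : ∀ {a τ} → IsPartition (a ∷ τ) → EvenStripStep (a ∷ τ) (suc a ∷ τ ++ ones 1)
growHead {a} {τ} p with IsPartition-∷⁻ p
... | _ , τ≤a , pτ = evenStripStep p pn strip grow
  where
  pn : IsPartition (suc a ∷ τ ++ ones 1)
  pn = IsPartition-∷ (s≤s z≤n) (part-++-ones-0 τ 1 (s≤s z≤n) (m≤n⇒m≤1+n τ≤a))
                     (IsPartition-++-ones τ 1 pτ)
  strip : VerticalStrip (a ∷ τ) (suc a ∷ τ ++ ones 1)
  strip = VerticalStrip-∷ (n≤1+n a) ≤-refl (VerticalStrip-++-ones τ 1)
  grow : suc a + size (τ ++ ones 1) ≡ 2 + (a + size τ)
  grow = cong suc (trans (cong (a +_) (trans (size-++-ones τ 1) (+-comm (size τ) 1)))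
                         (+-suc a (size τ)))

prependStep : ∀ {x l n} → 0 < x → part l 0 ≤ x → part n 0 ≤ x →
              EvenStripStep l n → EvenStripStep (x ∷ l) (x ∷ n)
prependStep {x} {l} {n} x>0 l≤x n≤x (pl , pn , strip , even) =
  IsPartition-∷ x>0 l≤x pl , IsPartition-∷ x>0 n≤x pn ,
  VerticalStrip-∷ ≤-refl (n≤1+n x) strip ,
  subst (2 ∣_) (sym ([m+n]∸[m+o]≡n∸o x (size n) (size l))) even

prependRowsStep : ∀ i {x l n} → 0 < x → part l 0 ≤ x → part n 0 ≤ x →
                  EvenStripStep l n → EvenStripStep (replicate i x ++ l) (replicate i x ++ n)
prependRowsStep zero    x>0 l≤x n≤x s = s
prependRowsStep (suc i) {l = l} {n} x>0 l≤x n≤x s =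
  prependStep x>0 (part-replicate-++-0 i l l≤x) (part-replicate-++-0 i n n≤x)
    (prependRowsStep i x>0 l≤x n≤x s)

module Filling (c : ℕ) where

  -- C ≥ 2, so filling the first row of a column of ones still leaves a row of length 1.
  C : ℕ
  C = 2 + c

  0<C : 0 < C
  0<C = s≤s z≤n

  growRow : ∀ i d a τ → IsPartition (a ∷ τ) → d + a ≤ C →
            Chain (replicate i C ++ a ∷ τ) (replicate i C ++ (d + a) ∷ τ ++ ones d)
  growRow i zero    a τ p _ =
    subst (λ σ → Chain (replicate i C ++ a ∷ τ) (replicate i C ++ a ∷ σ)) (sym (++-identityʳ τ)) ε
  growRow i (suc d) a τ p full =
    prependRowsStep i 0<C (≤-trans (m≤n+m a (suc d)) full) (≤-trans (s≤s (m≤n+m a d)) full) step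
    ◅ subst (Chain _) reassociate
        (growRow i d (suc a) (τ ++ ones 1) (target-IsPartition step)
                 (subst (_≤ C) (sym (+-suc d a)) full))
    where
    step = growHead p
    reassociate : replicate i C ++ (d + suc a) ∷ (τ ++ ones 1) ++ ones d
                ≡ replicate i C ++ (suc d + a) ∷ τ ++ ones (suc d)
    reassociate = cong (λ σ → replicate i C ++ σ)
      (cong₂ _∷_ (+-suc d a) (++-assoc τ (ones 1) (ones d)))

  fillRow : ∀ i a τ → IsPartition (a ∷ τ) → a ≤ C →
            Chain (replicate i C ++ a ∷ τ) (replicate (suc i) C ++ τ ++ ones (C ∸ a))
  fillRow i a τ p a≤C =
    subst (Chain _) (trans (cong (λ x → replicate i C ++ x ∷ τ ++ ones (C ∸ a)) filled)
                           (replicate-++-∷ i C (τ ++ ones (C ∸ a))))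
      (growRow i (C ∸ a) a τ p (≤-reflexive filled))
    where
    filled : C ∸ a + a ≡ C
    filled = m∸n+n≡m a≤C

  fillRows : ∀ L i π j → IsPartition π → part π 0 ≤ C → length π ≤ L →
             ∃[ j′ ] Chain (replicate i C ++ π ++ ones (suc j))
                           (replicate (L + i) C ++ ones (suc j′))
  fillRows zero    i []      j _ _ _ = j , ε
  fillRows (suc L) i []      j _ _ _ with fillRows L (suc i) [] (j + c) ([] , []) z≤n z≤n
  ... | j′ , rest =
    j′ , (fillRow i 1 (ones j) (IsPartition-ones (suc j)) 0<C
          ◅◅ subst₂ Chain (cong (replicate (suc i) C ++_) (sym onesEq))
                          (cong (λ k → replicate k C ++ ones (suc j′)) (+-suc L i)) rest)
    where
    onesEq : ones j ++ ones (suc c) ≡ ones (suc (j + c))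
    onesEq = trans (replicate-++ j (suc c) 1) (cong ones (+-suc j c))
  fillRows (suc L) i (a ∷ π) j p a≤C (s≤s len) with IsPartition-∷⁻ p
  ... | _ , π≤a , pπ with fillRows L (suc i) π (j + (C ∸ a)) pπ (≤-trans π≤a a≤C) len
  ... | j′ , rest =
    j′ , (fillRow i a (π ++ ones (suc j)) (IsPartition-++-ones (a ∷ π) (suc j) p) a≤C
          ◅◅ subst₂ Chain (cong (replicate (suc i) C ++_) (sym (++-ones-++ π (suc j) (C ∸ a))))
                          (cong (λ k → replicate k C ++ ones (suc j′)) (+-suc L i)) rest)

  reach : ∀ L {l} → IsPartition l → part l 0 ≤ C → length l ≤ L →
          ∃[ D ] Chain l (replicate L C ++ ones D)
  reach L {l} pl l≤C len with fillRows L 0 l 1 pl l≤C len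
  ... | j , filled =
    suc j , (appendOnes₂ pl ◅ subst (λ k → Chain _ (replicate k C ++ ones (suc j)))
                                    (+-identityʳ L) filled)

cancel-offsets : ∀ {a b c s x y} → a + b ≡ s + x → a + c ≡ s + y → c + x ≡ b + y
cancel-offsets {a} {b} {c} {s} {x} {y} eb ec = +-cancelˡ-≡ a (c + x) (b + y) (begin
  a + (c + x) ≡⟨ sym (+-assoc a c x) ⟩
  a + c + x   ≡⟨ cong (_+ x) ec ⟩
  s + y + x   ≡⟨ +-assoc s y x ⟩
  s + (y + x) ≡⟨ cong (s +_) (+-comm y x) ⟩
  s + (x + y) ≡⟨ sym (+-assoc s x y) ⟩
  s + x + y   ≡⟨ cong (_+ y) (sym eb) ⟩
  a + b + y   ≡⟨ +-assoc a b y ⟩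
  a + (b + y) ∎)
  where open ≡-Reasoning

commonExtension : ∀ {l μ} B D₁ D₂ → IsPartition l → IsPartition μ → size l ≡ size μ →
                  Chain l (B ++ ones D₁) → Chain μ (B ++ ones D₂) →
                  ∃[ k ] ∃[ ν ] (IsPartition ν × size ν ≡ size l + k * 2 × Chain l ν × Chain μ ν)
commonExtension {l} {μ} B D₁ D₂ pl pμ same c₁ c₂ with Chain-size c₁ | Chain-size c₂
... | k₁ , e₁ | k₂ , e₂ =
  k₁ + k₂ , B ++ ones (D₁ + k₂ * 2) , Chain-IsPartition chain₁ pl , sizeν , chain₁ ,
  subst (λ D → Chain μ (B ++ ones D)) sameLength (extend c₂ pμ k₁)
  where
  extend : ∀ {x D} → Chain x (B ++ ones D) → IsPartition x → ∀ t → Chain x (B ++ ones (D + t * 2))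
  extend {D = D} c px t =
    c ◅◅ subst (Chain _) (++-ones-++ B D (t * 2)) (appendEvenOnes (Chain-IsPartition c px) t)
  chain₁ = extend c₁ pl k₂
  e₁′ : size B + D₁ ≡ size l + k₁ * 2
  e₁′ = trans (sym (size-++-ones B D₁)) e₁
  e₂′ : size B + D₂ ≡ size l + k₂ * 2
  e₂′ = trans (sym (size-++-ones B D₂)) (trans e₂ (cong (_+ k₂ * 2) (sym same)))
  sameLength : D₂ + k₁ * 2 ≡ D₁ + k₂ * 2
  sameLength = cancel-offsets {size B} {D₁} {D₂} {size l} {k₁ * 2} {k₂ * 2} e₁′ e₂′
  sizeν : size (B ++ ones (D₁ + k₂ * 2)) ≡ size l + (k₁ + k₂) * 2
  sizeν = begin
    size (B ++ ones (D₁ + k₂ * 2)) ≡⟨ size-++-ones B (D₁ + k₂ * 2) ⟩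
    size B + (D₁ + k₂ * 2)         ≡⟨ sym (+-assoc (size B) D₁ (k₂ * 2)) ⟩
    size B + D₁ + k₂ * 2           ≡⟨ cong (_+ k₂ * 2) e₁′ ⟩
    size l + k₁ * 2 + k₂ * 2       ≡⟨ +-assoc (size l) (k₁ * 2) (k₂ * 2) ⟩
    size l + (k₁ * 2 + k₂ * 2)     ≡⟨ cong (size l +_) (sym (*-distribʳ-+ 2 k₁ k₂)) ⟩
    size l + (k₁ + k₂) * 2         ∎
    where open ≡-Reasoning

lemma4p10 : (m : ℕ) (l μ : List ℕ) → IsPartition l → IsPartition μ →
            size l ≡ m → size μ ≡ m →
            ∃[ n ] (InN m n × ∃[ ν ] (V n l ν × V n μ ν))
lemma4p10 m l μ pl pμ sl sμ =
  let (D₁ , c₁) = reach L pl (bounded l sl) (m≤m+n (length l) (length μ))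
      (D₂ , c₂) = reach L pμ (bounded μ sμ) (m≤n+m (length μ) (length l))
      (k , ν , pν , sν , cl , cμ) = commonExtension (replicate L C) D₁ D₂ pl pμ (trans sl (sym sμ)) c₁ c₂
      sizeν = trans sν (cong (_+ k * 2) sl)
  in m + k * 2 , (m≤m+n m (k * 2) , [m+kn]%n≡m%n m k 2) , ν , (pν , sizeν , cl) , (pν , sizeν , cμ)
  where
  open Filling m
  L = length l + length μ
  bounded : ∀ x → size x ≡ m → part x 0 ≤ C
  bounded x sx = ≤-trans (part0≤size x) (≤-trans (≤-reflexive sx) (m≤n+m m 2))
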